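{- Let $(u,v)$ be a Hofstadter G pair and let $\beta$ be a Fibonacci representation of $v$. Then $u+v=\mathrm{FibSum}(\langle0\rangle\|\beta)$ and $u+v+1=\mathrm{FibSum}(\langle1\rangle\|\beta)$.
   Context: $F_0=0$, $F_1=1$, $F_i=F_{i-1}+F_{i-2}$ are the Fibonacci numbers and $\phi=(1+\sqrt5)/2$. For a bit string $\beta=\langle\beta_1\ldots\beta_\ell\rangle$ ($\beta_i\in\{0,1\}$), $\mathrm{FibSum}(\beta)=\sum_{i=1}^\ell\beta_iF_{i+1}$; $\beta$ is a Fibonacci representation of $n$ if $\mathrm{FibSum}(\beta)=n$. $\langle b\rangle\|\beta$ denotes the string $\langle b\,\beta_1\ldots\beta_\ell\rangle$. Hofstadter's G function is $G(x)=\lfloor\phi^{ -1}(x+1)\rfloor$ for integers $x\ge0$. A Hofstadter G pair is a pair $(u,v)$ of positive integers with $u=G(v)$. -}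

module Defs where

open import Data.Nat using (ℕ; zero; suc; _+_; _*_; _∸_; _≤_; _<_)
open import Data.Bool using (Bool; true; false; if_then_else_)
open import Data.List using (List; []; _∷_)
open import Data.Product using (_×_)
open import Relation.Nullary using (¬_)

F : ℕ → ℕ
F zero = 0
F (suc zero) = 1
F (suc (suc i)) = F (suc i) + F i

-- Bit strings ⟨β₁ … β_ℓ⟩ are lists of Bool (head = β₁).
BitString : Set
BitString = List Bool

fibSumFrom : ℕ → BitString → ℕ
fibSumFrom k [] = 0
fibSumFrom k (b ∷ bs) = (if b then F (suc k) else 0) + fibSumFrom (suc k) bs

FibSum : BitString → ℕ
FibSum β = fibSumFrom 1 β

IsFibRep : BitString → ℕ → Set
IsFibRep β n = FibSum β ≡' n
  where
  open import Relation.Binary.PropositionalEquality renaming (_≡_ to _≡'_)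

-- Exact comparison  m · φ ≤ N  for naturals m, N, with φ = (1+√5)/2:
--   m(1+√5)/2 ≤ N  ⇔  m√5 ≤ 2N − m  ⇔  m ≤ 2N  and  5m² ≤ (2N − m)².
MulPhiLe : ℕ → ℕ → Set
MulPhiLe m N = (m ≤ 2 * N) × (5 * (m * m) ≤ (2 * N ∸ m) * (2 * N ∸ m))

-- G x = ⌊φ⁻¹ (x+1)⌋ is the unique u with u·φ ≤ x+1 < (u+1)·φ.
IsG : ℕ → ℕ → Set
IsG x u = MulPhiLe u (suc x) × ¬ MulPhiLe (suc u) (suc x)

HofstadterGPair : ℕ → ℕ → Set
HofstadterGPair u v = (0 < u) × (0 < v) × IsG v u

{-# OPTIONS --safe #-}
-- Write s = Σ βᵢ Fᵢ and v = Σ βᵢ Fᵢ₊₁ = FibSum β. By the Fibonacci recurrence u + v = s + v =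
-- FibSum (⟨0⟩ ∥ β) as soon as u = G v = s, i.e. s φ ≤ v + 1 < (s + 1) φ. Prepending a bit b to β
-- maps (s, v) to (v + b, v + s + b). Over ℕ, x φ < y reads x² + xy < y², and the strict bounds
-- s φ < v + 1 < (s + 1) φ survive this map because the form Q(x, y) = y² − xy − x² satisfies
-- Q(x, x + y) = − Q(y, x).
module Submission where

open import Defs
open import Data.Nat using (ℕ; _+_)
open import Data.Bool using (true; false)
open import Data.List using (_∷_)
open import Data.Product using (_×_)
open import Relation.Binary.PropositionalEquality using (_≡_)

open import Data.Nat using (suc; _*_; _∸_; _≤_; _<_; z≤n; s≤s)
open import Data.Nat.Properties
open import Data.Nat.Tactic.RingSolver using (solve-∀)
open import Data.List using ([])
open import Data.Product using (_,_)
open import Relation.Binary.Definitions using (tri<; tri≈; tri>)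
open import Relation.Binary.PropositionalEquality using (refl; sym; trans; cong; subst; subst₂; module ≡-Reasoning)
open import Data.Empty using (⊥-elim)

fibSumFrom-rec : ∀ k β → fibSumFrom (suc (suc k)) β ≡ fibSumFrom (suc k) β + fibSumFrom k β
fibSumFrom-rec k [] = refl
fibSumFrom-rec k (false ∷ β) = fibSumFrom-rec (suc k) β
fibSumFrom-rec k (true ∷ β) = begin
    (F (2 + k) + F (1 + k)) + fibSumFrom (3 + k) β
      ≡⟨ cong (F (2 + k) + F (1 + k) +_) (fibSumFrom-rec (suc k) β) ⟩
    (F (2 + k) + F (1 + k)) + (fibSumFrom (2 + k) β + fibSumFrom (1 + k) β)
      ≡⟨ +-interchange (F (2 + k)) (F (1 + k)) _ _ ⟩
    (F (2 + k) + fibSumFrom (2 + k) β) + (F (1 + k) + fibSumFrom (1 + k) β) ∎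
  where
  open ≡-Reasoning
  +-interchange : ∀ p q r t → (p + q) + (r + t) ≡ (p + r) + (q + t)
  +-interchange = solve-∀

-- Since φ² = φ + 1, for naturals x, y the comparison of x φ with y is that of x² + x y with y².
golden : ℕ → ℕ → ℕ
golden x y = x * x + x * y

infix 4 _φ≤_ _φ<_ _<φ_

_φ≤_ : ℕ → ℕ → Set
x φ≤ y = golden x y ≤ y * y

_φ<_ : ℕ → ℕ → Set
x φ< y = golden x y < y * y

_<φ_ : ℕ → ℕ → Set
y <φ x = y * y < golden x y

golden-monoˡ-≤ : ∀ {x x′} y → x ≤ x′ → golden x y ≤ golden x′ y
golden-monoˡ-≤ y x≤x′ = +-mono-≤ (*-mono-≤ x≤x′ x≤x′) (*-monoˡ-≤ y x≤x′)

φ<⇒< : ∀ {x y} → x φ< y → x < y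
φ<⇒< {x} {y} xφ<y = ≰⇒> λ y≤x → <⇒≱ xφ<y (≤-trans (*-mono-≤ y≤x y≤x) (m≤m+n (x * x) (x * y)))

golden-suc : ∀ x y → x * x + x * suc y ≡ (x * x + x * y) + x
golden-suc = solve-∀

square-suc : ∀ y → suc y * suc y ≡ y * y + (y + suc y)
square-suc = solve-∀

φ<-suc : ∀ {x y} → x φ< y → x φ< suc y
φ<-suc {x} {y} xφ<y = subst₂ _<_ (sym (golden-suc x y)) (sym (square-suc y))
  (+-mono-<-≤ xφ<y (≤-trans (<⇒≤ (φ<⇒< xφ<y)) (m≤m+n y (suc y))))

suc<φ⇒<φ : ∀ {x y} → x ≤ suc y → suc y <φ x → y <φ x
suc<φ⇒<φ {x} {y} x≤1+y 1+y<φx = +-cancelʳ-< (y + suc y) (y * y) (golden x y) (begin-strict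
  y * y + (y + suc y)     ≡⟨ square-suc y ⟨
  suc y * suc y           <⟨ 1+y<φx ⟩
  golden x (suc y)        ≡⟨ golden-suc x y ⟩
  golden x y + x          ≤⟨ +-monoʳ-≤ (golden x y) (≤-trans x≤1+y (m≤n+m (suc y) y)) ⟩
  golden x y + (y + suc y) ∎)
  where open ≤-Reasoning

-- Q(x, x + y) = − Q(y, x), with both sides moved so that no subtraction occurs.
golden-shift : ∀ x y → (x + y) * (x + y) + x * x ≡ (x * x + x * (x + y)) + (y * y + y * x)
golden-shift = solve-∀

<-of-balance : ∀ {a b c d} → a + c ≡ b + d → d < c → a < b
<-of-balance {a} {b} {c} {d} a+c≡b+d d<c =
  +-cancelʳ-< c a b (subst (_< b + c) (sym a+c≡b+d) (+-monoʳ-< b d<c))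

<φ⇒φ<+ : ∀ {x y} → x <φ y → x φ< x + y
<φ⇒φ<+ {x} {y} x<φy = <-of-balance (sym (golden-shift x y)) x<φy

φ<⇒+<φ : ∀ {x y} → y φ< x → x + y <φ x
φ<⇒+<φ {x} {y} yφ<x = <-of-balance (golden-shift x y) yφ<x

-- s φ < v + 1 < (s + 1) φ; the left bound of IsG v s is strict anyway, φ being irrational.
StrictG : ℕ → ℕ → Set
StrictG v s = s φ< suc v × suc v <φ suc s

StrictG-step₀ : ∀ {s v} → StrictG v s → StrictG (v + s) v
StrictG-step₀ {s} {v} (sφ<1+v , 1+v<φ1+s) =
  subst (v φ<_) (+-suc v s)
    (<φ⇒φ<+ {v} {suc s} (suc<φ⇒<φ {suc s} {v} (φ<⇒< {s} sφ<1+v) 1+v<φ1+s)) ,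
  φ<⇒+<φ {suc v} {s} sφ<1+v

StrictG-step₁ : ∀ {s v} → StrictG v s → StrictG (suc (v + s)) (suc v)
StrictG-step₁ {s} {v} (sφ<1+v , 1+v<φ1+s) =
  subst (suc v φ<_) (cong suc (+-suc v s)) (<φ⇒φ<+ {suc v} {suc s} 1+v<φ1+s) ,
  φ<⇒+<φ {suc (suc v)} {s} (φ<-suc {s} {suc v} sφ<1+v)

StrictG-fibSum : ∀ β → StrictG (fibSumFrom 1 β) (fibSumFrom 0 β)
StrictG-fibSum [] = s≤s z≤n , s≤s (s≤s z≤n)
StrictG-fibSum (false ∷ β) =
  subst (λ v′ → StrictG v′ (fibSumFrom 1 β)) (sym (fibSumFrom-rec 0 β))
    (StrictG-step₀ {fibSumFrom 0 β} (StrictG-fibSum β))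
StrictG-fibSum (true ∷ β) =
  subst (λ v′ → StrictG (suc v′) (suc (fibSumFrom 1 β))) (sym (fibSumFrom-rec 0 β))
    (StrictG-step₁ {fibSumFrom 0 β} (StrictG-fibSum β))

-- MulPhiLe compares 5 m² with (2n − m)²; the two comparisons agree because of this identity.
golden-MulPhiLe-identity : ∀ m n w → m + w ≡ 2 * n → 4 * golden m n + w * w ≡ 4 * (n * n) + 5 * (m * m)
golden-MulPhiLe-identity m n w m+w≡2n = begin
  4 * (m * m + m * n) + w * w           ≡⟨ expand m n w ⟩
  4 * (m * m) + 2 * m * (2 * n) + w * w ≡⟨ cong (λ t → 4 * (m * m) + 2 * m * t + w * w) m+w≡2n ⟨
  4 * (m * m) + 2 * m * (m + w) + w * w ≡⟨ regroup m w ⟩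
  (m + w) * (m + w) + 5 * (m * m)       ≡⟨ cong (λ t → t * t + 5 * (m * m)) m+w≡2n ⟩
  (2 * n) * (2 * n) + 5 * (m * m)       ≡⟨ square-double n (m * m) ⟩
  4 * (n * n) + 5 * (m * m)             ∎
  where
  open ≡-Reasoning
  expand : ∀ m n w → 4 * (m * m + m * n) + w * w ≡ 4 * (m * m) + 2 * m * (2 * n) + w * w
  expand = solve-∀
  regroup : ∀ m w → 4 * (m * m) + 2 * m * (m + w) + w * w ≡ (m + w) * (m + w) + 5 * (m * m)
  regroup = solve-∀
  square-double : ∀ n k → (2 * n) * (2 * n) + 5 * k ≡ 4 * (n * n) + 5 * k
  square-double = solve-∀

MulPhiLe⇒φ≤ : ∀ {m n} → MulPhiLe m n → m φ≤ n
MulPhiLe⇒φ≤ {m} {n} (m≤2n , 5m²≤w²) =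
  *-cancelˡ-≤ 4 (+-cancelʳ-≤ (w * w) (4 * golden m n) (4 * (n * n)) (begin
  4 * golden m n + w * w    ≡⟨ golden-MulPhiLe-identity m n w (m+[n∸m]≡n m≤2n) ⟩
  4 * (n * n) + 5 * (m * m) ≤⟨ +-monoʳ-≤ (4 * (n * n)) 5m²≤w² ⟩
  4 * (n * n) + w * w       ∎))
  where
  open ≤-Reasoning
  w = 2 * n ∸ m

φ≤⇒MulPhiLe : ∀ {m n} → m ≤ 2 * n → m φ≤ n → MulPhiLe m n
φ≤⇒MulPhiLe {m} {n} m≤2n mφ≤n = m≤2n , +-cancelˡ-≤ (4 * (n * n)) (5 * (m * m)) (w * w) (begin
  4 * (n * n) + 5 * (m * m) ≡⟨ golden-MulPhiLe-identity m n w (m+[n∸m]≡n m≤2n) ⟨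
  4 * golden m n + w * w    ≤⟨ +-monoˡ-≤ (w * w) (*-monoʳ-≤ 4 mφ≤n) ⟩
  4 * (n * n) + w * w       ∎)
  where
  open ≤-Reasoning
  w = 2 * n ∸ m

IsG-unique : ∀ {v u s} → IsG v u → StrictG v s → u ≡ s
IsG-unique {v} {u} {s} (uφ≤1+v , ¬1+uφ≤1+v) (sφ<1+v , 1+v<φ1+s) with <-cmp u s
... | tri≈ _ u≡s _ = u≡s
... | tri< u<s _ _ = ⊥-elim (¬1+uφ≤1+v (φ≤⇒MulPhiLe 1+u≤2+2v
  (≤-trans (golden-monoˡ-≤ (suc v) u<s) (<⇒≤ sφ<1+v))))
  where
  1+u≤2+2v : suc u ≤ 2 * suc v
  1+u≤2+2v = ≤-trans (≤-trans u<s (<⇒≤ (φ<⇒< {s} sφ<1+v))) (m≤n*m (suc v) 2)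
... | tri> _ _ s<u = ⊥-elim (<⇒≱ 1+v<φ1+s
  (≤-trans (golden-monoˡ-≤ (suc v) s<u) (MulPhiLe⇒φ≤ uφ≤1+v)))

lemma4 : (u v : ℕ) (β : BitString) → HofstadterGPair u v → IsFibRep β v →
    (u + v ≡ FibSum (false ∷ β)) × (u + v + 1 ≡ FibSum (true ∷ β))
lemma4 u v β (_ , _ , isG) refl = u+v≡ , trans (+-comm (u + FibSum β) 1) (cong suc u+v≡)
  where
  open ≡-Reasoning
  u+v≡ : u + FibSum β ≡ FibSum (false ∷ β)
  u+v≡ = begin
    u + fibSumFrom 1 β              ≡⟨ cong (_+ fibSumFrom 1 β) (IsG-unique isG (StrictG-fibSum β)) ⟩
    fibSumFrom 0 β + fibSumFrom 1 β ≡⟨ +-comm (fibSumFrom 0 β) (fibSumFrom 1 β) ⟩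
    fibSumFrom 1 β + fibSumFrom 0 β ≡⟨ fibSumFrom-rec 0 β ⟨
    fibSumFrom 2 β                  ∎
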